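{- Let $p$ be a prime, $d\in\mathbb N$, and $T=(t_{ij})\in M_d(\mathbb F_p)$. Suppose there exists $C\geq 1$ such that $|t_{ij}|\leq C$ for all $i,j$, and $T$ is not invertible. Then there exists a nonzero vector $(a_1,\dots,a_d)\in\mathbb F_p^d$ with $|a_i|\leq d!\,C^d$ for all $i$ such that $(a_1,a_2,\dots,a_d)T=0$.
   Context: $M_d(\mathbb F_p)$ is the ring of $d\times d$ matrices over the field $\mathbb F_p$. For $x\in\mathbb F_p$, its integer height is $|x|=\min\{|a|: a\in\mathbb Z,\ a\equiv x\pmod p\}$. -}

module Defs where

open import Data.Nat using (ℕ; zero; suc; _+_; _*_; _∸_; _⊓_; NonZero)
open import Data.Nat.DivMod using (_mod_)
open import Data.Fin using (Fin; toℕ; _≟_)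
open import Data.List using (tabulate)
open import Data.Nat.ListAction using (sum)
open import Data.Product using (Σ; _×_)
open import Relation.Binary.PropositionalEquality using (_≡_)
open import Relation.Nullary using (does)
open import Data.Bool using (if_then_else_)

-- Elements of 𝔽_p are represented as residues 0 … p-1, i.e. Fin p;
-- all arithmetic is done in ℕ and reduced mod p.

Fp : ℕ → Set
Fp p = Fin p

Mat : ℕ → ℕ → Set
Mat p d = Fin d → Fin d → Fp p

Vecp : ℕ → ℕ → Set
Vecp p d = Fin d → Fp p

module _ {p : ℕ} .{{_ : NonZero p}} where

  0ₚ : Fp p
  0ₚ = 0 mod p

  1ₚ : Fp p
  1ₚ = 1 mod p

  -- integer height |x| = min { |a| : a ∈ ℤ, a ≡ x mod p } = min (r , p - r)
  height : Fp p → ℕ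
  height x = toℕ x ⊓ (p ∸ toℕ x)

  _·_ : {d : ℕ} → Mat p d → Mat p d → Mat p d
  _·_ {d} A B i k = sum (tabulate {n = d} (λ j → toℕ (A i j) * toℕ (B j k))) mod p

  I : {d : ℕ} → Mat p d
  I i j = if does (i ≟ j) then 1ₚ else 0ₚ

  _⋆_ : {d : ℕ} → Vecp p d → Mat p d → Vecp p d
  _⋆_ {d} a T j = sum (tabulate {n = d} (λ i → toℕ (a i) * toℕ (T i j))) mod p

  Invertible : {d : ℕ} → Mat p d → Set
  Invertible {d} T = Σ (Mat p d) (λ S → ((i j : Fin d) → (S · T) i j ≡ I i j)
                                      × ((i j : Fin d) → (T · S) i j ≡ I i j))

-- Lift T to the integer matrix M of least-absolute-value representatives, so that
-- |M i j| ≤ C, and argue with congruences mod p. Adding the rows of M one at a time,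
-- either they stay independent mod p, witnessed by a square minor whose determinant is
-- nonzero mod p, or, at the first row where this fails, the signed minors of the pivot
-- columns found so far (the cofactors along a new column) form a nonzero vector
-- annihilating M mod p; each of them is a determinant, hence bounded by k! C^k.
-- If all d rows are independent then T is invertible: a left inverse comes from the same
-- dichotomy applied to M with a unit row on top, and independence makes it two-sided.

module Submission where

open import Defs

open import Data.Bool.Base using (true; false; if_then_else_)
open import Data.Empty using (⊥-elim)
open import Data.Fin.Base using (Fin; zero; suc; toℕ; punchIn; fromℕ<)
open import Data.Fin.Properties using (_≟_; any?; pigeonhole; <⇒≢; toℕ<n; toℕ-fromℕ<; toℕ-injective)
open import Data.Integer.DivMod using (a≡a%ℕn+[a/ℕn]*n; n%ℕd<d)
open import Data.Integer.Divisibility.Signed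
  using (_∣_; divides; _∣?_; ∣m∣n⇒∣m+n; ∣m⇒∣-m; ∣m⇒∣m*n; ∣n⇒∣m*n; ∣⇒∣ᵤ)
import Data.Integer.Properties as ℤₚ
open import Algebra.Properties.Semiring.Sum ℤₚ.+-*-semiring
  using (sum; sum-syntax; sum-cong-≗; sum-replicate-zero; ∑-comm; *-distribˡ-sum; *-distribʳ-sum)
open import Data.Integer.Tactic.RingSolver using (solve-∀)
open import Data.List.Base using (tabulate)
open import Data.Nat.Base as ℕ using (ℕ; zero; suc; _≤_; _!; NonZero)
open import Data.Nat.Coprimality using (coprime-Bézout; prime⇒coprime)
open import Data.Nat.Divisibility using (∣1⇒≡1; >⇒∤) renaming (_∣_ to _∣ℕ_)
open import Data.Nat.DivMod using (_mod_; m%n≤m; m%n<n)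
open import Data.Nat.GCD using (module Bézout)
open import Data.Nat.ListAction using () renaming (sum to sumℕ)
open import Data.Nat.Primality using (Prime; ¬prime[1])
import Data.Nat.Properties as ℕₚ
open import Data.Nat.Tactic.RingSolver using () renaming (solve-∀ to ℕ-solve-∀)
open import Data.Product.Base using (Σ; ∃; _×_; _,_; proj₁; proj₂)
open import Data.Sum.Base using (_⊎_; inj₁; inj₂)
open import Data.Vec.Functional using (_∷_)
open import Function.Base using (_∘_; case_of_)
open import Level using (0ℓ)
open import Relation.Binary.Bundles using (Setoid)
open import Relation.Binary.Definitions using (Decidable)
open import Relation.Binary.PropositionalEquality
  using (_≡_; _≢_; refl; sym; trans; cong; cong₂; subst; module ≡-Reasoning)
import Relation.Binary.Reasoning.Setoid as SetoidReasoning
open import Relation.Nullary using (¬_; does; yes; no)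
open import Relation.Nullary.Decidable using (map′; ¬?; decidable-stable)

!*^-mono : ∀ k {C} → 1 ≤ C → k ! ℕ.* C ℕ.^ k ≤ suc k ! ℕ.* C ℕ.^ suc k
!*^-mono k {C} 1≤C = ℕₚ.*-mono-≤ (ℕₚ.m≤n*m (k !) (suc k)) (ℕₚ.m≤n*m (C ℕ.^ k) C {{ℕ.>-nonZero 1≤C}})

module IntegerMatrices where

  open import Data.Integer.Base using (ℤ; +_; -_; _+_; _*_; _-_; ∣_∣; 0ℤ; 1ℤ; -1ℤ)

  sum-zero : ∀ {n} {f : Fin n → ℤ} → (∀ i → f i ≡ 0ℤ) → sum f ≡ 0ℤ
  sum-zero {n} f≡0 = trans (sum-cong-≗ f≡0) (sum-replicate-zero n)

  sum-neg : ∀ {n} (f : Fin n → ℤ) → ∑[ i < n ] (- f i) ≡ - sum f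
  sum-neg {n} f = begin
    ∑[ i < n ] (- f i)      ≡⟨ sum-cong-≗ (λ i → sym (ℤₚ.-1*i≡-i (f i))) ⟩
    ∑[ i < n ] (-1ℤ * f i)  ≡⟨ *-distribˡ-sum -1ℤ f ⟨
    -1ℤ * sum f             ≡⟨ ℤₚ.-1*i≡-i (sum f) ⟩
    - sum f                 ∎
    where open ≡-Reasoning

  ∣sum∣≤ : ∀ {n} (f : Fin n → ℤ) {B} → (∀ i → ∣ f i ∣ ≤ B) → ∣ sum f ∣ ≤ n ℕ.* B
  ∣sum∣≤ {zero} f _ = ℕ.z≤n
  ∣sum∣≤ {suc n} f f≤B = ℕₚ.≤-trans (ℤₚ.∣i+j∣≤∣i∣+∣j∣ (f zero) _)
    (ℕₚ.+-mono-≤ (f≤B zero) (∣sum∣≤ (f ∘ suc) (f≤B ∘ suc)))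

  +-sum-tabulate : ∀ {n} (f : Fin n → ℕ) → + sumℕ (tabulate f) ≡ ∑[ i < n ] (+ f i)
  +-sum-tabulate {zero} f = refl
  +-sum-tabulate {suc n} f = trans (ℤₚ.pos-+ (f zero) _) (cong (_+_ (+ f zero)) (+-sum-tabulate (f ∘ suc)))

  pos-a+b*c≡d*e : ∀ a b c d e → a ℕ.+ b ℕ.* c ≡ d ℕ.* e → + a + + b * + c ≡ + d * + e
  pos-a+b*c≡d*e a b c d e eq = begin
    + a + + b * + c      ≡⟨ cong (_+_ (+ a)) (ℤₚ.pos-* b c) ⟨
    + a + + (b ℕ.* c)    ≡⟨ ℤₚ.pos-+ a (b ℕ.* c) ⟨
    + (a ℕ.+ b ℕ.* c)    ≡⟨ cong +_ eq ⟩
    + (d ℕ.* e)          ≡⟨ ℤₚ.pos-* d e ⟩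
    + d * + e            ∎
    where open ≡-Reasoning

  x≡-x⇒x≡0 : ∀ x → x ≡ - x → x ≡ 0ℤ
  x≡-x⇒x≡0 x x≡-x = ℤₚ.*-cancelˡ-≡ (+ 2) x 0ℤ (begin
    + 2 * x   ≡⟨ double x ⟩
    x + x     ≡⟨ cong (_+_ x) x≡-x ⟩
    x + - x   ≡⟨ ℤₚ.+-inverseʳ x ⟩
    0ℤ        ≡⟨ ℤₚ.*-zeroʳ (+ 2) ⟨
    + 2 * 0ℤ  ∎)
    where
    open ≡-Reasoning
    double : ∀ x → + 2 * x ≡ x + x
    double = solve-∀

  sign : ℕ → ℤ
  sign zero = 1ℤ
  sign (suc n) = - sign n

  ∣sign∣≡1 : ∀ n → ∣ sign n ∣ ≡ 1
  ∣sign∣≡1 zero = refl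
  ∣sign∣≡1 (suc n) = trans (ℤₚ.∣-i∣≡∣i∣ (sign n)) (∣sign∣≡1 n)

  ∣sign*x∣≡∣x∣ : ∀ n x → ∣ sign n * x ∣ ≡ ∣ x ∣
  ∣sign*x∣≡∣x∣ n x = trans (ℤₚ.abs-* (sign n) x) (trans (cong (ℕ._* ∣ x ∣) (∣sign∣≡1 n)) (ℕₚ.*-identityˡ ∣ x ∣))

  Matrix : ℕ → ℕ → Set
  Matrix k m = Fin k → Fin m → ℤ

  Bounded : ∀ {k m} → ℕ → Matrix k m → Set
  Bounded C A = ∀ i j → ∣ A i j ∣ ≤ C

  infix 10 _ᵀ
  _ᵀ : ∀ {k m} → Matrix k m → Matrix m k
  (A ᵀ) i j = A j i

  infixl 8 _⇂_
  _⇂_ : ∀ {k m l} → Matrix k m → (Fin l → Fin m) → Matrix k l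
  (M ⇂ σ) i l = M i (σ l)

  minor : ∀ {k m} → Fin (suc k) → Fin (suc m) → Matrix (suc k) (suc m) → Matrix k m
  minor r c A i j = A (punchIn r i) (punchIn c j)

  det : ∀ {n} → Matrix n n → ℤ
  det {zero} A = 1ℤ
  det {suc n} A = ∑[ r < suc n ] (sign (toℕ r) * A r zero * det (minor r zero A))

  det-cong : ∀ {n} (A B : Matrix n n) → (∀ i j → A i j ≡ B i j) → det A ≡ det B
  det-cong {zero} _ _ _ = refl
  det-cong {suc n} A B A≡B = sum-cong-≗ λ r → cong₂ (λ a d → sign (toℕ r) * a * d) (A≡B r zero)
    (det-cong (minor r zero A) (minor r zero B) (λ i j → A≡B (punchIn r i) (suc j)))

  -- Expanding the minors once more, both sides become the same double sum over the
  -- minors D r c of A without rows 0, r + 1 and columns 0, c + 1.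
  det-expand-row₀ : ∀ {n} (A : Matrix (suc n) (suc n)) →
    det A ≡ ∑[ c < suc n ] (sign (toℕ c) * A zero c * det (minor zero c A))
  det-expand-row₀ {zero} A = refl
  det-expand-row₀ {suc n} A = cong (_+_ (sign 0 * A zero zero * det (minor zero zero A))) (begin
    ∑[ r < suc n ] (sign (suc (toℕ r)) * a r * det (minor (suc r) zero A))
      ≡⟨ sum-cong-≗ (λ r → cong (sign (suc (toℕ r)) * a r *_) (det-expand-row₀ (minor (suc r) zero A))) ⟩
    ∑[ r < suc n ] (sign (suc (toℕ r)) * a r * ∑[ c < suc n ] (sign (toℕ c) * b c * D r c))
      ≡⟨ sum-cong-≗ (λ r → *-distribˡ-sum (sign (suc (toℕ r)) * a r) (λ c → sign (toℕ c) * b c * D r c)) ⟩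
    ∑[ r < suc n ] ∑[ c < suc n ] (sign (suc (toℕ r)) * a r * (sign (toℕ c) * b c * D r c))
      ≡⟨ ∑-comm (λ r c → sign (suc (toℕ r)) * a r * (sign (toℕ c) * b c * D r c)) ⟩
    ∑[ c < suc n ] ∑[ r < suc n ] (sign (suc (toℕ r)) * a r * (sign (toℕ c) * b c * D r c))
      ≡⟨ sum-cong-≗ (λ c → sum-cong-≗ (λ r → exchange (sign (toℕ r)) (a r) (sign (toℕ c)) (b c) (D r c))) ⟩
    ∑[ c < suc n ] ∑[ r < suc n ] (sign (suc (toℕ c)) * b c * (sign (toℕ r) * a r * D r c))
      ≡⟨ sum-cong-≗ (λ c → *-distribˡ-sum (sign (suc (toℕ c)) * b c) (λ r → sign (toℕ r) * a r * D r c)) ⟨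
    ∑[ c < suc n ] (sign (suc (toℕ c)) * b c * det (minor zero (suc c) A)) ∎)
    where
    open ≡-Reasoning
    a b : Fin (suc n) → ℤ
    a r = A (suc r) zero
    b c = A zero (suc c)
    D : Fin (suc n) → Fin (suc n) → ℤ
    D r c = det (minor r c (minor zero zero A))
    exchange : ∀ s a t b d → - s * a * (t * b * d) ≡ - t * b * (s * a * d)
    exchange = solve-∀

  det-transpose : ∀ {n} (A : Matrix n n) → det (A ᵀ) ≡ det A
  det-transpose {zero} A = refl
  det-transpose {suc n} A = trans
    (sum-cong-≗ λ c → cong (sign (toℕ c) * A zero c *_) (det-transpose (minor zero c A)))
    (sym (det-expand-row₀ A))

  swap₀₁ : ∀ {n} → Fin (suc (suc n)) → Fin (suc (suc n))
  swap₀₁ zero = suc zero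
  swap₀₁ (suc zero) = zero
  swap₀₁ (suc (suc i)) = suc (suc i)

  expansion-tail : ∀ {n} → Matrix (suc (suc n)) (suc (suc n)) → ℤ
  expansion-tail {n} A =
    ∑[ r < n ] (sign (toℕ (suc (suc r))) * A (suc (suc r)) zero * det (minor (suc (suc r)) zero A))

  -- In the expansion along column 0 the swap exchanges the terms for rows 0 and 1,
  -- while for the rows r ≥ 2 it acts inside the minor.
  mutual
    det-swap₀₁ : ∀ {n} (A : Matrix (suc (suc n)) (suc (suc n))) → det (A ∘ swap₀₁) ≡ - det A
    det-swap₀₁ A = begin
      det (A ∘ swap₀₁)
        ≡⟨⟩
      1ℤ * a₁ * det (minor zero zero (A ∘ swap₀₁)) + (-1ℤ * a₀ * det (minor (suc zero) zero (A ∘ swap₀₁))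
        + expansion-tail (A ∘ swap₀₁))
        ≡⟨ cong₂ (λ x y → 1ℤ * a₁ * x + (-1ℤ * a₀ * y + expansion-tail (A ∘ swap₀₁))) minor₀₀ minor₁₀ ⟩
      1ℤ * a₁ * d₁ + (-1ℤ * a₀ * d₀ + expansion-tail (A ∘ swap₀₁))
        ≡⟨ cong (λ t → 1ℤ * a₁ * d₁ + (-1ℤ * a₀ * d₀ + t)) (expansion-tail-swap₀₁ A) ⟩
      1ℤ * a₁ * d₁ + (-1ℤ * a₀ * d₀ + - expansion-tail A)
        ≡⟨ negate-expansion a₀ a₁ d₀ d₁ (expansion-tail A) ⟩
      - (1ℤ * a₀ * d₀ + (-1ℤ * a₁ * d₁ + expansion-tail A))
        ≡⟨⟩
      - det A ∎
      where
      open ≡-Reasoning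
      a₀ = A zero zero
      a₁ = A (suc zero) zero
      d₀ = det (minor zero zero A)
      d₁ = det (minor (suc zero) zero A)
      minor₀₀ : det (minor zero zero (A ∘ swap₀₁)) ≡ d₁
      minor₀₀ = det-cong (minor zero zero (A ∘ swap₀₁)) (minor (suc zero) zero A)
        λ { zero j → refl ; (suc i) j → refl }
      minor₁₀ : det (minor (suc zero) zero (A ∘ swap₀₁)) ≡ d₀
      minor₁₀ = det-cong (minor (suc zero) zero (A ∘ swap₀₁)) (minor zero zero A)
        λ { zero j → refl ; (suc i) j → refl }
      negate-expansion : ∀ a₀ a₁ d₀ d₁ t →
        1ℤ * a₁ * d₁ + (-1ℤ * a₀ * d₀ + - t) ≡ - (1ℤ * a₀ * d₀ + (-1ℤ * a₁ * d₁ + t))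
      negate-expansion = solve-∀

    expansion-tail-swap₀₁ : ∀ {n} (A : Matrix (suc (suc n)) (suc (suc n))) →
      expansion-tail (A ∘ swap₀₁) ≡ - expansion-tail A
    expansion-tail-swap₀₁ {zero} A = refl
    expansion-tail-swap₀₁ {suc n} A = begin
      ∑[ r < suc n ] (s r * det (minor (r +2) zero (A ∘ swap₀₁)))
        ≡⟨ sum-cong-≗ (λ r → cong (s r *_) (trans (minor-swap₀₁ r) (det-swap₀₁ (minor (r +2) zero A)))) ⟩
      ∑[ r < suc n ] (s r * - det (minor (r +2) zero A))
        ≡⟨ sum-cong-≗ (λ r → ℤₚ.neg-distribʳ-* (s r) (det (minor (r +2) zero A))) ⟨
      ∑[ r < suc n ] (- (s r * det (minor (r +2) zero A)))
        ≡⟨ sum-neg (λ r → s r * det (minor (r +2) zero A)) ⟩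
      - expansion-tail A ∎
      where
      open ≡-Reasoning
      _+2 : Fin (suc n) → Fin (suc (suc (suc n)))
      r +2 = suc (suc r)
      s : Fin (suc n) → ℤ
      s r = sign (toℕ (r +2)) * A (r +2) zero
      minor-swap₀₁ : ∀ r → det (minor (r +2) zero (A ∘ swap₀₁)) ≡ det (minor (r +2) zero A ∘ swap₀₁)
      minor-swap₀₁ r = det-cong (minor (r +2) zero (A ∘ swap₀₁)) (minor (r +2) zero A ∘ swap₀₁)
        λ { zero j → refl ; (suc zero) j → refl ; (suc (suc i)) j → refl }

  swap₀₁-equal-rows : ∀ {n} (A : Matrix (suc (suc n)) (suc (suc n))) →
    (∀ c → A zero c ≡ A (suc zero) c) → ∀ r c → A r c ≡ A (swap₀₁ r) c
  swap₀₁-equal-rows A eq zero c = eq c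
  swap₀₁-equal-rows A eq (suc zero) c = sym (eq c)
  swap₀₁-equal-rows A eq (suc (suc r)) c = refl

  mutual
    det-equal-rows : ∀ {n} (A : Matrix n n) {i j : Fin n} → i ≢ j → (∀ c → A i c ≡ A j c) → det A ≡ 0ℤ
    det-equal-rows A {zero} {zero} i≢j _ = ⊥-elim (i≢j refl)
    det-equal-rows A {zero} {suc j} _ eq = det-equal-row₀ A eq
    det-equal-rows A {suc i} {zero} _ eq = det-equal-row₀ A (sym ∘ eq)
    det-equal-rows A {suc i} {suc j} i≢j eq = det-equal-suc-rows A (i≢j ∘ cong suc) eq

    det-equal-row₀ : ∀ {n} (A : Matrix (suc n) (suc n)) {j : Fin n} →
      (∀ c → A zero c ≡ A (suc j) c) → det A ≡ 0ℤ
    det-equal-row₀ {suc n} A {zero} eq =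
      x≡-x⇒x≡0 (det A) (trans (det-cong A (A ∘ swap₀₁) (swap₀₁-equal-rows A eq)) (det-swap₀₁ A))
    det-equal-row₀ {suc n} A {suc j} eq = begin
      det A                   ≡⟨ ℤₚ.neg-involutive (det A) ⟨
      - - det A               ≡⟨ cong -_ (det-swap₀₁ A) ⟨
      - det (A ∘ swap₀₁)      ≡⟨ cong -_ (det-equal-suc-rows (A ∘ swap₀₁) {zero} {suc j} (λ ()) eq) ⟩
      0ℤ                      ∎
      where open ≡-Reasoning

    det-equal-suc-rows : ∀ {n} (A : Matrix (suc n) (suc n)) {i j : Fin n} → i ≢ j →
      (∀ c → A (suc i) c ≡ A (suc j) c) → det A ≡ 0ℤ
    det-equal-suc-rows A i≢j eq = trans (det-expand-row₀ A) (sum-zero λ c →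
      trans (cong (sign (toℕ c) * A zero c *_) (det-equal-rows (minor zero c A) i≢j (eq ∘ punchIn c)))
            (ℤₚ.*-zeroʳ (sign (toℕ c) * A zero c)))

  det-equal-columns : ∀ {n} (A : Matrix n n) {i j : Fin n} → i ≢ j → (∀ r → A r i ≡ A r j) → det A ≡ 0ℤ
  det-equal-columns A i≢j eq = trans (sym (det-transpose A)) (det-equal-rows (A ᵀ) i≢j eq)

  ∣det∣≤ : ∀ {n C} (A : Matrix n n) → Bounded C A → ∣ det A ∣ ≤ n ! ℕ.* C ℕ.^ n
  ∣det∣≤ {zero} A _ = ℕₚ.≤-refl
  ∣det∣≤ {suc n} {C} A A≤C = ℕₚ.≤-trans (∣sum∣≤ (λ r → sign (toℕ r) * A r zero * det (minor r zero A)) term≤)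
    (ℕₚ.≤-reflexive (rearrange (suc n) (n !) C (C ℕ.^ n)))
    where
    open ℕₚ.≤-Reasoning
    term≤ : ∀ r → ∣ sign (toℕ r) * A r zero * det (minor r zero A) ∣ ≤ C ℕ.* (n ! ℕ.* C ℕ.^ n)
    term≤ r = begin
      ∣ sign (toℕ r) * A r zero * det (minor r zero A) ∣
        ≡⟨ ℤₚ.abs-* (sign (toℕ r) * A r zero) _ ⟩
      ∣ sign (toℕ r) * A r zero ∣ ℕ.* ∣ det (minor r zero A) ∣
        ≡⟨ cong (ℕ._* ∣ det (minor r zero A) ∣) (∣sign*x∣≡∣x∣ (toℕ r) (A r zero)) ⟩
      ∣ A r zero ∣ ℕ.* ∣ det (minor r zero A) ∣
        ≤⟨ ℕₚ.*-mono-≤ (A≤C r zero) (∣det∣≤ (minor r zero A) (λ i j → A≤C (punchIn r i) (suc j))) ⟩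
      C ℕ.* (n ! ℕ.* C ℕ.^ n) ∎
    rearrange : ∀ m f c e → m ℕ.* (c ℕ.* (f ℕ.* e)) ≡ m ℕ.* f ℕ.* (c ℕ.* e)
    rearrange = ℕ-solve-∀

  infixl 7 _⊛_
  _⊛_ : ∀ {k m} → (Fin k → ℤ) → Matrix k m → Fin m → ℤ
  (_⊛_ {k} a M) j = ∑[ i < k ] (a i * M i j)

  ⊛-sub : ∀ {k m} (a b : Fin k → ℤ) (M : Matrix k m) j →
    ((λ i → a i - b i) ⊛ M) j ≡ (a ⊛ M) j - (b ⊛ M) j
  ⊛-sub {zero} a b M j = refl
  ⊛-sub {suc k} a b M j = trans
    (cong (_+_ ((a zero - b zero) * M zero j)) (⊛-sub (a ∘ suc) (b ∘ suc) (M ∘ suc) j))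
    (distribute (a zero) (b zero) (M zero j) ((a ∘ suc ⊛ M ∘ suc) j) ((b ∘ suc ⊛ M ∘ suc) j))
    where
    distribute : ∀ a b m s t → (a - b) * m + (s - t) ≡ a * m + s - (b * m + t)
    distribute = solve-∀

  ⊛-scale : ∀ {k m} u (a : Fin k → ℤ) (M : Matrix k m) j → ((λ i → u * a i) ⊛ M) j ≡ u * (a ⊛ M) j
  ⊛-scale u a M j = trans (sum-cong-≗ λ i → ℤₚ.*-assoc u (a i) (M i j)) (sym (*-distribˡ-sum u (λ i → a i * M i j)))

  ⊛-assoc : ∀ {k l m} (a : Fin k → ℤ) (L : Matrix k l) (M : Matrix l m) j →
    ((a ⊛ L) ⊛ M) j ≡ (a ⊛ (λ i → L i ⊛ M)) j
  ⊛-assoc {k} {l} a L M j = begin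
    ∑[ c < l ] (∑[ i < k ] (a i * L i c) * M c j)
      ≡⟨ sum-cong-≗ (λ c → *-distribʳ-sum (M c j) (λ i → a i * L i c)) ⟩
    ∑[ c < l ] ∑[ i < k ] (a i * L i c * M c j)
      ≡⟨ ∑-comm (λ c i → a i * L i c * M c j) ⟩
    ∑[ i < k ] ∑[ c < l ] (a i * L i c * M c j)
      ≡⟨ sum-cong-≗ (λ i → sum-cong-≗ (λ c → ℤₚ.*-assoc (a i) (L i c) (M c j))) ⟩
    ∑[ i < k ] ∑[ c < l ] (a i * (L i c * M c j))
      ≡⟨ sum-cong-≗ (λ i → *-distribˡ-sum (a i) (λ c → L i c * M c j)) ⟨
    ∑[ i < k ] (a i * (L i ⊛ M) j) ∎
    where open ≡-Reasoning

  δ : ∀ {n} → Fin n → Fin n → ℤ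
  δ i j = + (if does (i ≟ j) then 1 else 0)

  δ-⊛ : ∀ {n m} (r : Fin n) (M : Matrix n m) j → (δ r ⊛ M) j ≡ M r j
  δ-⊛ {suc n} zero M j =
    trans (cong₂ _+_ (ℤₚ.*-identityˡ (M zero j)) (sum-zero {n} (λ _ → refl))) (ℤₚ.+-identityʳ (M zero j))
  δ-⊛ {suc n} (suc r) M j = trans (ℤₚ.+-identityˡ ((δ r ⊛ M ∘ suc) j)) (δ-⊛ r (M ∘ suc) j)

  ⊛-δ : ∀ {n} (a : Fin n → ℤ) j → (a ⊛ δ) j ≡ a j
  ⊛-δ {suc n} a zero = trans (cong₂ _+_ (ℤₚ.*-identityʳ (a zero)) (sum-zero (λ i → ℤₚ.*-zeroʳ (a (suc i)))))
    (ℤₚ.+-identityʳ (a zero))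
  ⊛-δ {suc n} a (suc j) = trans (cong (_+ (a ∘ suc ⊛ δ) j) (ℤₚ.*-zeroʳ (a zero)))
    (trans (ℤₚ.+-identityˡ ((a ∘ suc ⊛ δ) j)) (⊛-δ (a ∘ suc) j))

  ⊛-eliminate-head : ∀ {k m} (a c : Fin (suc k) → ℤ) (M : Matrix (suc k) m) j →
    ((λ i → a zero * c (suc i) - c zero * a (suc i)) ⊛ M ∘ suc) j ≡ a zero * (c ⊛ M) j - c zero * (a ⊛ M) j
  ⊛-eliminate-head a c M j = begin
    ((λ i → a zero * c (suc i) - c zero * a (suc i)) ⊛ M ∘ suc) j
      ≡⟨ ⊛-sub (λ i → a zero * c (suc i)) (λ i → c zero * a (suc i)) (M ∘ suc) j ⟩
    ((λ i → a zero * c (suc i)) ⊛ M ∘ suc) j - ((λ i → c zero * a (suc i)) ⊛ M ∘ suc) j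
      ≡⟨ cong₂ _-_ (⊛-scale (a zero) (c ∘ suc) (M ∘ suc) j) (⊛-scale (c zero) (a ∘ suc) (M ∘ suc) j) ⟩
    a zero * (c ∘ suc ⊛ M ∘ suc) j - c zero * (a ∘ suc ⊛ M ∘ suc) j
      ≡⟨ cancel-heads (a zero) (c zero) (M zero j) ((c ∘ suc ⊛ M ∘ suc) j) ((a ∘ suc ⊛ M ∘ suc) j) ⟩
    a zero * (c ⊛ M) j - c zero * (a ⊛ M) j ∎
    where
    open ≡-Reasoning
    cancel-heads : ∀ a₀ c₀ m s t → a₀ * s - c₀ * t ≡ a₀ * (c₀ * m + s) - c₀ * (a₀ * m + t)
    cancel-heads = solve-∀

  cofactors : ∀ {k m} → Matrix (suc k) m → (Fin k → Fin m) → Fin (suc k) → ℤ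
  cofactors M σ r = sign (toℕ r) * det ((M ∘ punchIn r) ⇂ σ)

  cofactors-⊛ : ∀ {k m} (M : Matrix (suc k) m) (σ : Fin k → Fin m) j →
    (cofactors M σ ⊛ M) j ≡ det (M ⇂ (j ∷ σ))
  cofactors-⊛ M σ j = sum-cong-≗ λ r → swap-last (sign (toℕ r)) (det ((M ∘ punchIn r) ⇂ σ)) (M r j)
    where
    swap-last : ∀ s d m → s * d * m ≡ s * m * d
    swap-last = solve-∀

  cofactors-⊛-pivot : ∀ {k m} (M : Matrix (suc k) m) (σ : Fin k → Fin m) l → (cofactors M σ ⊛ M) (σ l) ≡ 0ℤ
  cofactors-⊛-pivot M σ l =
    trans (cofactors-⊛ M σ (σ l)) (det-equal-columns (M ⇂ (σ l ∷ σ)) {zero} {suc l} (λ ()) (λ r → refl))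

  ∣cofactors∣≤ : ∀ {k m C} (M : Matrix (suc k) m) (σ : Fin k → Fin m) → Bounded C M →
    ∀ r → ∣ cofactors M σ r ∣ ≤ k ! ℕ.* C ℕ.^ k
  ∣cofactors∣≤ M σ M≤C r = ℕₚ.≤-trans (ℕₚ.≤-reflexive (∣sign*x∣≡∣x∣ (toℕ r) _))
    (∣det∣≤ ((M ∘ punchIn r) ⇂ σ) (λ i l → M≤C (punchIn r i) (σ l)))

module Congruence (p : ℕ) where

  open import Data.Integer.Base using (ℤ; +_; -_; _+_; _*_; _-_; 0ℤ; _%ℕ_; _/ℕ_)
  open IntegerMatrices

  infix 4 _≈_ _≉_

  -- A record rather than a synonym for p ∣ x - y, so that x and y can be inferred.
  record _≈_ (x y : ℤ) : Set where
    constructor mk≈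
    field
      p∣x-y : + p ∣ x - y

  open _≈_ public

  _≉_ : ℤ → ℤ → Set
  x ≉ y = ¬ x ≈ y

  _≈?_ : Decidable _≈_
  x ≈? y = map′ mk≈ p∣x-y (+ p ∣? (x - y))

  ≈-reflexive : ∀ {x y} → x ≡ y → x ≈ y
  ≈-reflexive {x} refl = mk≈ (divides 0ℤ (ℤₚ.+-inverseʳ x))

  ≈-refl : ∀ {x} → x ≈ x
  ≈-refl = ≈-reflexive refl

  ≈-sym : ∀ {x y} → x ≈ y → y ≈ x
  ≈-sym {x} {y} (mk≈ p∣x-y) = mk≈ (subst (+ p ∣_) (negate x y) (∣m⇒∣-m p∣x-y))
    where
    negate : ∀ x y → - (x - y) ≡ y - x
    negate = solve-∀

  ≈-trans : ∀ {x y z} → x ≈ y → y ≈ z → x ≈ z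
  ≈-trans {x} {y} {z} (mk≈ p∣x-y) (mk≈ p∣y-z) =
    mk≈ (subst (+ p ∣_) (telescope x y z) (∣m∣n⇒∣m+n p∣x-y p∣y-z))
    where
    telescope : ∀ x y z → (x - y) + (y - z) ≡ x - z
    telescope = solve-∀

  ≈-setoid : Setoid 0ℓ 0ℓ
  ≈-setoid = record
    { _≈_ = _≈_
    ; isEquivalence = record { refl = ≈-refl ; sym = ≈-sym ; trans = ≈-trans }
    }

  module ≈-Reasoning = SetoidReasoning ≈-setoid

  +-cong : ∀ {x x′ y y′} → x ≈ x′ → y ≈ y′ → x + y ≈ x′ + y′
  +-cong {x} {x′} {y} {y′} (mk≈ p∣x-x′) (mk≈ p∣y-y′) =
    mk≈ (subst (+ p ∣_) (regroup x x′ y y′) (∣m∣n⇒∣m+n p∣x-x′ p∣y-y′))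
    where
    regroup : ∀ x x′ y y′ → (x - x′) + (y - y′) ≡ (x + y) - (x′ + y′)
    regroup = solve-∀

  *-cong : ∀ {x x′ y y′} → x ≈ x′ → y ≈ y′ → x * y ≈ x′ * y′
  *-cong {x} {x′} {y} {y′} (mk≈ p∣x-x′) (mk≈ p∣y-y′) =
    mk≈ (subst (+ p ∣_) (regroup x x′ y y′) (∣m∣n⇒∣m+n (∣m⇒∣m*n y p∣x-x′) (∣n⇒∣m*n x′ p∣y-y′)))
    where
    regroup : ∀ x x′ y y′ → (x - x′) * y + x′ * (y - y′) ≡ x * y - x′ * y′
    regroup = solve-∀

  -‿cong : ∀ {x x′} → x ≈ x′ → - x ≈ - x′
  -‿cong {x} {x′} (mk≈ p∣x-x′) = mk≈ (subst (+ p ∣_) (negate x x′) (∣m⇒∣-m p∣x-x′))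
    where
    negate : ∀ x x′ → - (x - x′) ≡ - x - - x′
    negate = solve-∀

  +-congʳ : ∀ y {x x′} → x ≈ x′ → x + y ≈ x′ + y
  +-congʳ y x≈x′ = +-cong x≈x′ (≈-refl {y})

  *-congˡ : ∀ x {y y′} → y ≈ y′ → x * y ≈ x * y′
  *-congˡ x = *-cong (≈-refl {x})

  *-congʳ : ∀ y {x x′} → x ≈ x′ → x * y ≈ x′ * y
  *-congʳ y x≈x′ = *-cong x≈x′ (≈-refl {y})

  sum-cong : ∀ {n} {f g : Fin n → ℤ} → (∀ i → f i ≈ g i) → sum f ≈ sum g
  sum-cong {zero} _ = ≈-refl
  sum-cong {suc n} f≈g = +-cong (f≈g zero) (sum-cong (f≈g ∘ suc))

  y≈-x : ∀ {x y} → x + y ≈ 0ℤ → y ≈ - x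
  y≈-x {x} {y} x+y≈0 = begin
    y              ≡⟨ add-and-subtract x y ⟩
    x + y - x      ≈⟨ +-congʳ (- x) x+y≈0 ⟩
    0ℤ - x         ≡⟨ ℤₚ.+-identityˡ (- x) ⟩
    - x            ∎
    where
    open ≈-Reasoning
    add-and-subtract : ∀ x y → y ≡ x + y - x
    add-and-subtract = solve-∀

  x-y≈0⇒x≈y : ∀ {x y} → x - y ≈ 0ℤ → x ≈ y
  x-y≈0⇒x≈y {x} {y} x-y≈0 = begin
    x              ≡⟨ subtract-and-add x y ⟩
    x - y + y      ≈⟨ +-congʳ y x-y≈0 ⟩
    0ℤ + y         ≡⟨ ℤₚ.+-identityˡ y ⟩
    y              ∎
    where
    open ≈-Reasoning
    subtract-and-add : ∀ x y → x ≡ x - y + y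
    subtract-and-add = solve-∀

  %ℕ-≈ : .{{_ : NonZero p}} → ∀ x → + (x %ℕ p) ≈ x
  %ℕ-≈ x = mk≈ (divides (- (x /ℕ p)) (begin
    + (x %ℕ p) - x                           ≡⟨ cong (_-_ (+ (x %ℕ p))) (a≡a%ℕn+[a/ℕn]*n x p) ⟩
    + (x %ℕ p) - (+ (x %ℕ p) + x /ℕ p * + p) ≡⟨ cancel (+ (x %ℕ p)) (x /ℕ p) (+ p) ⟩
    - (x /ℕ p) * + p                         ∎))
    where
    open ≡-Reasoning
    cancel : ∀ r q p → r - (r + q * p) ≡ - q * p
    cancel = solve-∀

  ⊛-congˡ : ∀ {k m} {a b : Fin k → ℤ} (M : Matrix k m) → (∀ i → a i ≈ b i) → ∀ j → (a ⊛ M) j ≈ (b ⊛ M) j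
  ⊛-congˡ M a≈b j = sum-cong λ i → *-congʳ (M i j) (a≈b i)

  ⊛-congʳ : ∀ {k m} (a : Fin k → ℤ) {M N : Matrix k m} → (∀ i j → M i j ≈ N i j) →
    ∀ j → (a ⊛ M) j ≈ (a ⊛ N) j
  ⊛-congʳ a M≈N j = sum-cong λ i → *-congˡ (a i) (M≈N i j)

  ⊛-≈0 : ∀ {k m} {a : Fin k → ℤ} (M : Matrix k m) → (∀ i → a i ≈ 0ℤ) → ∀ j → (a ⊛ M) j ≈ 0ℤ
  ⊛-≈0 {k} M a≈0 j = ≈-trans (⊛-congˡ M a≈0 j) (≈-reflexive (sum-zero {k} (λ _ → refl)))

  ⊛-tail≈0 : ∀ {k m} (a : Fin (suc k) → ℤ) (M : Matrix (suc k) m) → a zero ≈ 0ℤ →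
    ∀ j → (a ⊛ M) j ≈ 0ℤ → (a ∘ suc ⊛ M ∘ suc) j ≈ 0ℤ
  ⊛-tail≈0 a M a₀≈0 j a⊛M≈0 = begin
    (a ∘ suc ⊛ M ∘ suc) j                     ≡⟨ ℤₚ.+-identityˡ _ ⟨
    0ℤ + (a ∘ suc ⊛ M ∘ suc) j                ≈⟨ +-congʳ ((a ∘ suc ⊛ M ∘ suc) j) (*-congʳ (M zero j) (≈-sym a₀≈0)) ⟩
    a zero * M zero j + (a ∘ suc ⊛ M ∘ suc) j ≈⟨ a⊛M≈0 ⟩
    0ℤ                                        ∎
    where open ≈-Reasoning

module Residues (p : ℕ) .{{_ : NonZero p}} where

  open import Data.Integer.Base using (ℤ; +_; -[1+_]; -_; _+_; _*_; _-_; ∣_∣; 0ℤ; 1ℤ; _%ℕ_)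
  open IntegerMatrices
  open Congruence p

  lift : Fp p → ℤ
  lift x with toℕ x ℕₚ.≤? p ℕ.∸ toℕ x
  ... | yes _ = + toℕ x
  ... | no _ = - + (p ℕ.∸ toℕ x)

  ∣lift∣≡height : ∀ x → ∣ lift x ∣ ≡ height x
  ∣lift∣≡height x with toℕ x ℕₚ.≤? p ℕ.∸ toℕ x
  ... | yes x≤p-x = sym (ℕₚ.m≤n⇒m⊓n≡m x≤p-x)
  ... | no x≰p-x =
    trans (ℤₚ.∣-i∣≡∣i∣ (+ (p ℕ.∸ toℕ x))) (sym (ℕₚ.m≥n⇒m⊓n≡n (ℕₚ.<⇒≤ (ℕₚ.≰⇒> x≰p-x))))

  toℕ≈lift : ∀ x → + toℕ x ≈ lift x
  toℕ≈lift x with toℕ x ℕₚ.≤? p ℕ.∸ toℕ x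
  ... | yes _ = ≈-refl
  ... | no _ = mk≈ (divides 1ℤ (begin
    + toℕ x - - + (p ℕ.∸ toℕ x)     ≡⟨ cong (_+_ (+ toℕ x)) (ℤₚ.neg-involutive (+ (p ℕ.∸ toℕ x))) ⟩
    + toℕ x + + (p ℕ.∸ toℕ x)       ≡⟨ ℤₚ.pos-+ (toℕ x) (p ℕ.∸ toℕ x) ⟨
    + (toℕ x ℕ.+ (p ℕ.∸ toℕ x))     ≡⟨ cong +_ (ℕₚ.m+[n∸m]≡n (ℕₚ.<⇒≤ (toℕ<n x))) ⟩
    + p                             ≡⟨ ℤₚ.*-identityˡ (+ p) ⟨
    1ℤ * + p                        ∎))
    where open ≡-Reasoning

  liftᴹ : ∀ {d} → Mat p d → Matrix d d
  liftᴹ T i j = lift (T i j)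

  liftᴹ-bounded : ∀ {d C} (T : Mat p d) → (∀ i j → height (T i j) ≤ C) → Bounded C (liftᴹ T)
  liftᴹ-bounded T T≤C i j = ℕₚ.≤-trans (ℕₚ.≤-reflexive (∣lift∣≡height (T i j))) (T≤C i j)

  reduce : ℤ → Fp p
  reduce x = fromℕ< (n%ℕd<d x p)

  toℕ-reduce : ∀ x → toℕ (reduce x) ≡ x %ℕ p
  toℕ-reduce x = toℕ-fromℕ< (n%ℕd<d x p)

  toℕ-reduce≈ : ∀ x → + toℕ (reduce x) ≈ x
  toℕ-reduce≈ x = ≈-trans (≈-reflexive (cong +_ (toℕ-reduce x))) (%ℕ-≈ x)

  %ℕ-height≤ : ∀ x → x %ℕ p ℕ.⊓ (p ℕ.∸ x %ℕ p) ≤ ∣ x ∣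
  %ℕ-height≤ (+ n) = ℕₚ.≤-trans (ℕₚ.m⊓n≤m (n ℕ.% p) _) (m%n≤m n p)
  %ℕ-height≤ -[1+ n ] with suc n ℕ.% p | m%n≤m (suc n) p | m%n<n (suc n) p
  ... | zero | _ | _ = ℕ.z≤n
  ... | suc r | r≤n | r<p = ℕₚ.≤-trans (ℕₚ.m⊓n≤n (p ℕ.∸ suc r) _)
    (subst (_≤ suc n) (sym (ℕₚ.m∸[m∸n]≡n (ℕₚ.<⇒≤ r<p))) r≤n)

  height-reduce≤ : ∀ x → height (reduce x) ≤ ∣ x ∣
  height-reduce≤ x = subst (λ r → r ℕ.⊓ (p ℕ.∸ r) ≤ ∣ x ∣) (sym (toℕ-reduce x)) (%ℕ-height≤ x)

  toℕ-mod≈ : ∀ n → + toℕ (n mod p) ≈ + n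
  toℕ-mod≈ n = ≈-trans (≈-reflexive (cong +_ (toℕ-fromℕ< (m%n<n n p)))) (%ℕ-≈ (+ n))

  ≈⇒≡-below-p : ∀ {m n} → m ℕ.< p → n ℕ.< p → + m ≈ + n → m ≡ n
  ≈⇒≡-below-p {m} {n} m<p n<p (mk≈ p∣m-n) =
    ℤₚ.+-injective (ℤₚ.i-j≡0⇒i≡j (+ m) (+ n) (ℤₚ.∣i∣≡0⇒i≡0 (multiple<p⇒0 ∣m-n∣<p (∣⇒∣ᵤ p∣m-n))))
    where
    ∣m-n∣<p : ∣ + m - + n ∣ ℕ.< p
    ∣m-n∣<p = subst (λ z → ∣ z ∣ ℕ.< p) (sym (ℤₚ.m-n≡m⊖n m n))
      (ℕₚ.≤-<-trans (ℤₚ.∣m⊝n∣≤m⊔n m n) (ℕₚ.⊔-pres-<m m<p n<p))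
    multiple<p⇒0 : ∀ {d} → d ℕ.< p → p ∣ℕ d → d ≡ 0
    multiple<p⇒0 {zero} _ _ = refl
    multiple<p⇒0 {suc d} d<p p∣d = ⊥-elim (>⇒∤ d<p p∣d)

  mod-cong : ∀ {m n} → + m ≈ + n → m mod p ≡ n mod p
  mod-cong {m} {n} m≈n = toℕ-injective (≈⇒≡-below-p (toℕ<n (m mod p)) (toℕ<n (n mod p))
    (≈-trans (toℕ-mod≈ m) (≈-trans m≈n (≈-sym (toℕ-mod≈ n)))))

  reduce≢0ₚ : ∀ {x} → x ≉ 0ℤ → reduce x ≢ 0ₚ
  reduce≢0ₚ {x} x≉0 reduce≡0 = x≉0 (begin
    x                      ≈⟨ toℕ-reduce≈ x ⟨
    + toℕ (reduce x)       ≡⟨ cong (+_ ∘ toℕ) reduce≡0 ⟩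
    + toℕ (0 mod p)        ≈⟨ toℕ-mod≈ 0 ⟩
    0ℤ                     ∎)
    where open ≈-Reasoning

  ⋆≡mod : ∀ {d} (a : Vecp p d) (T : Mat p d) (a′ : Fin d → ℤ) (M : Matrix d d) →
    (∀ i → + toℕ (a i) ≈ a′ i) → (∀ i j → + toℕ (T i j) ≈ M i j) →
    ∀ {j n} → (a′ ⊛ M) j ≈ + n → (a ⋆ T) j ≡ n mod p
  ⋆≡mod {d} a T a′ M a≈a′ T≈M {j} {n} a′⊛M≈n = mod-cong (begin
    + sumℕ (tabulate (λ i → toℕ (a i) ℕ.* toℕ (T i j)))
      ≡⟨ +-sum-tabulate (λ i → toℕ (a i) ℕ.* toℕ (T i j)) ⟩
    ∑[ i < d ] (+ (toℕ (a i) ℕ.* toℕ (T i j)))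
      ≡⟨ sum-cong-≗ (λ i → ℤₚ.pos-* (toℕ (a i)) (toℕ (T i j))) ⟩
    ∑[ i < d ] (+ toℕ (a i) * + toℕ (T i j))
      ≈⟨ sum-cong (λ i → *-cong (a≈a′ i) (T≈M i j)) ⟩
    (a′ ⊛ M) j
      ≈⟨ a′⊛M≈n ⟩
    + n ∎)
    where open ≈-Reasoning

  δ-mod≡I : ∀ {d} (i j : Fin d) → (if does (i ≟ j) then 1 else 0) mod p ≡ I i j
  δ-mod≡I i j with does (i ≟ j)
  ... | true = refl
  ... | false = refl

module PrimeModulus {p : ℕ} .{{_ : NonZero p}} (p-prime : Prime p) where

  open import Data.Integer.Base using (ℤ; +_; -_; _+_; _*_; _-_; ∣_∣; 0ℤ; 1ℤ; _%ℕ_)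
  open IntegerMatrices
  open Congruence p public
  open Residues p public

  1≉0 : 1ℤ ≉ 0ℤ
  1≉0 (mk≈ p∣1) = ¬prime[1] (subst Prime (∣1⇒≡1 (∣⇒∣ᵤ p∣1)) p-prime)

  bézout⇒inverse : ∀ {r} → Bézout.Identity 1 p r → ∃ λ u → u * + r ≈ 1ℤ
  bézout⇒inverse {r} (Bézout.+- a b 1+br≡ap) = - + b , mk≈ (divides (- + a) (begin
    - + b * + r - 1ℤ        ≡⟨ rearrange (+ b) (+ r) ⟩
    - (1ℤ + + b * + r)      ≡⟨ cong -_ (pos-a+b*c≡d*e 1 b r a p 1+br≡ap) ⟩
    - (+ a * + p)           ≡⟨ ℤₚ.neg-distribˡ-* (+ a) (+ p) ⟩
    - + a * + p             ∎))
    where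
    open ≡-Reasoning
    rearrange : ∀ b r → - b * r - 1ℤ ≡ - (1ℤ + b * r)
    rearrange = solve-∀
  bézout⇒inverse {r} (Bézout.-+ a b 1+ap≡br) = + b , mk≈ (divides (+ a) (begin
    + b * + r - 1ℤ          ≡⟨ cong (_- 1ℤ) (pos-a+b*c≡d*e 1 a p b r 1+ap≡br) ⟨
    1ℤ + + a * + p - 1ℤ     ≡⟨ cancel (+ a * + p) ⟩
    + a * + p               ∎))
    where
    open ≡-Reasoning
    cancel : ∀ x → 1ℤ + x - 1ℤ ≡ x
    cancel = solve-∀

  -- Users take the witness apart by pattern matching: a projection would make Agda
  -- evaluate the Bézout computation.
  ≉0⇒invertible : ∀ {x} → x ≉ 0ℤ → ∃ λ u → u * x ≈ 1ℤ
  ≉0⇒invertible {x} x≉0 =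
    transfer (bézout⇒inverse (coprime-Bézout (prime⇒coprime p-prime (n%ℕd<d x p))))
    where
    r≢0 : x %ℕ p ≢ 0
    r≢0 r≡0 = x≉0 (≈-trans (≈-sym (%ℕ-≈ x)) (≈-reflexive (cong +_ r≡0)))
    instance
      r-nonZero : NonZero (x %ℕ p)
      r-nonZero = ℕ.≢-nonZero r≢0
    transfer : (∃ λ u → u * + (x %ℕ p) ≈ 1ℤ) → ∃ λ u → u * x ≈ 1ℤ
    transfer (u , u*r≈1) = u , ≈-trans (*-congˡ u (≈-sym (%ℕ-≈ x))) u*r≈1

  *-cancelʳ-≉0 : ∀ {x y} → y ≉ 0ℤ → x * y ≈ 0ℤ → x ≈ 0ℤ
  *-cancelʳ-≉0 {x} {y} y≉0 x*y≈0 = cancel (≉0⇒invertible y≉0)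
    where
    open ≈-Reasoning
    cancel : (∃ λ u → u * y ≈ 1ℤ) → x ≈ 0ℤ
    cancel (u , u*y≈1) = begin
      x              ≡⟨ ℤₚ.*-identityʳ x ⟨
      x * 1ℤ         ≈⟨ *-congˡ x (≈-sym u*y≈1) ⟩
      x * (u * y)    ≡⟨ rearrange x u y ⟩
      u * (x * y)    ≈⟨ *-congˡ u x*y≈0 ⟩
      u * 0ℤ         ≡⟨ ℤₚ.*-zeroʳ u ⟩
      0ℤ             ∎
      where
      rearrange : ∀ x u y → x * (u * y) ≡ u * (x * y)
      rearrange = solve-∀

  RowsIndependent : ∀ {k m} → Matrix k m → Set
  RowsIndependent {k} M = ∀ (a : Fin k → ℤ) → (∀ j → (a ⊛ M) j ≈ 0ℤ) → ∀ i → a i ≈ 0ℤ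

  -- Independence on the pivot columns is kept as data: deriving it from det≉0 would need
  -- the adjugate.
  record FullRowRank {k m} (M : Matrix k m) : Set where
    field
      pivots : Fin k → Fin m
      det≉0 : det (M ⇂ pivots) ≉ 0ℤ
      pivots-independent : RowsIndependent (M ⇂ pivots)

    rows-independent : RowsIndependent M
    rows-independent a a⊛M≈0 = pivots-independent a (a⊛M≈0 ∘ pivots)

  record SmallLeftKernelVector {k m} (M : Matrix k m) : Set where
    field
      vector : Fin k → ℤ
      nonzero : ∃ λ i → vector i ≉ 0ℤ
      annihilates : ∀ j → (vector ⊛ M) j ≈ 0ℤ
      -- stated for every entry bound C, so that the dichotomy below needs none
      small : ∀ {C} → 1 ≤ C → Bounded C M → ∀ i → ∣ vector i ∣ ≤ k ! ℕ.* C ℕ.^ k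

  open FullRowRank
  open SmallLeftKernelVector

  -- w = a₀ c − c₀ a has no row 0 and, like the cofactor vector c, annihilates the pivot
  -- columns; hence w ≡ 0, and then a₀ det ≡ 0 by the cofactor expansion along column j.
  extend-independent : ∀ {k m} (M : Matrix (suc k) m) (σ : Fin k → Fin m) j →
    RowsIndependent (M ∘ suc ⇂ σ) → det (M ⇂ (j ∷ σ)) ≉ 0ℤ → RowsIndependent (M ⇂ (j ∷ σ))
  extend-independent M σ j tail-independent det≉0 a a⊛M≈0 = λ { zero → a₀≈0 ; (suc i) → a∘suc≈0 i }
    where
    open ≈-Reasoning
    c = cofactors M σ
    w : Fin _ → ℤ
    w i = a zero * c (suc i) - c zero * a (suc i)
    w≈0 : ∀ i → w i ≈ 0ℤ
    w≈0 = tail-independent w λ l → begin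
      (w ⊛ M ∘ suc) (σ l)
        ≡⟨ ⊛-eliminate-head a c M (σ l) ⟩
      a zero * (c ⊛ M) (σ l) - c zero * (a ⊛ M) (σ l)
        ≈⟨ +-cong (*-congˡ (a zero) (≈-reflexive (cofactors-⊛-pivot M σ l)))
                  (-‿cong (*-congˡ (c zero) (a⊛M≈0 (suc l)))) ⟩
      a zero * 0ℤ - c zero * 0ℤ
        ≡⟨ vanish (a zero) (c zero) ⟩
      0ℤ ∎
      where
      vanish : ∀ a c → a * 0ℤ - c * 0ℤ ≡ 0ℤ
      vanish = solve-∀
    a₀≈0 : a zero ≈ 0ℤ
    a₀≈0 = *-cancelʳ-≉0 det≉0 (begin
      a zero * det (M ⇂ (j ∷ σ))
        ≡⟨ cong (a zero *_) (cofactors-⊛ M σ j) ⟨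
      a zero * (c ⊛ M) j
        ≡⟨ add-and-subtract (a zero * (c ⊛ M) j) (c zero * (a ⊛ M) j) ⟩
      (a zero * (c ⊛ M) j - c zero * (a ⊛ M) j) + c zero * (a ⊛ M) j
        ≡⟨ cong (_+ c zero * (a ⊛ M) j) (⊛-eliminate-head a c M j) ⟨
      (w ⊛ M ∘ suc) j + c zero * (a ⊛ M) j
        ≈⟨ +-cong (⊛-≈0 (M ∘ suc) w≈0 j) (*-congˡ (c zero) (a⊛M≈0 zero)) ⟩
      0ℤ + c zero * 0ℤ
        ≡⟨ vanish (c zero) ⟩
      0ℤ ∎)
      where
      add-and-subtract : ∀ x y → x ≡ (x - y) + y
      add-and-subtract = solve-∀
      vanish : ∀ c → 0ℤ + c * 0ℤ ≡ 0ℤ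
      vanish = solve-∀
    a∘suc≈0 : ∀ i → a (suc i) ≈ 0ℤ
    a∘suc≈0 = tail-independent (a ∘ suc) λ l → ⊛-tail≈0 a (M ⇂ (j ∷ σ)) a₀≈0 (suc l) (a⊛M≈0 (suc l))

  prepend-zero : ∀ {k m} (M : Matrix (suc k) m) →
    SmallLeftKernelVector (M ∘ suc) → SmallLeftKernelVector M
  prepend-zero {k} M v = record
    { vector = 0ℤ ∷ vector v
    ; nonzero = let i , vᵢ≉0 = nonzero v in suc i , vᵢ≉0
    ; annihilates = λ j → ≈-trans (≈-reflexive (ℤₚ.+-identityˡ _)) (annihilates v j)
    ; small = small′
    }
    where
    small′ : ∀ {C} → 1 ≤ C → Bounded C M → ∀ i → ∣ (0ℤ ∷ vector v) i ∣ ≤ suc k ! ℕ.* C ℕ.^ suc k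
    small′ 1≤C M≤C zero = ℕ.z≤n
    small′ 1≤C M≤C (suc i) = ℕₚ.≤-trans (small v 1≤C (M≤C ∘ suc) i) (!*^-mono k 1≤C)

  cofactor-kernel-vector : ∀ {k m} (M : Matrix (suc k) m) (σ : Fin k → Fin m) →
    det (M ∘ suc ⇂ σ) ≉ 0ℤ → (∀ j → det (M ⇂ (j ∷ σ)) ≈ 0ℤ) → SmallLeftKernelVector M
  cofactor-kernel-vector {k} M σ det≉0 dets≈0 = record
    { vector = cofactors M σ
    ; nonzero = zero , λ c₀≈0 → det≉0 (≈-trans (≈-reflexive (sym (ℤₚ.*-identityˡ _))) c₀≈0)
    ; annihilates = λ j → ≈-trans (≈-reflexive (cofactors-⊛ M σ j)) (dets≈0 j)
    ; small = λ 1≤C M≤C r → ℕₚ.≤-trans (∣cofactors∣≤ M σ M≤C r) (!*^-mono k 1≤C)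
    }

  fullRowRank⊎smallLeftKernelVector : ∀ {k m} (M : Matrix k m) →
    FullRowRank M ⊎ SmallLeftKernelVector M
  fullRowRank⊎smallLeftKernelVector {zero} M = inj₁ record
    { pivots = λ ()
    ; det≉0 = 1≉0
    ; pivots-independent = λ _ _ ()
    }
  fullRowRank⊎smallLeftKernelVector {suc k} M with fullRowRank⊎smallLeftKernelVector (M ∘ suc)
  ... | inj₂ v = inj₂ (prepend-zero M v)
  ... | inj₁ r with any? (λ j → ¬? (det (M ⇂ (j ∷ pivots r)) ≈? 0ℤ))
  ...   | yes (j , det≉0) = inj₁ record
    { pivots = j ∷ pivots r
    ; det≉0 = det≉0
    ; pivots-independent = extend-independent M (pivots r) j (pivots-independent r) det≉0
    }
  ...   | no no-pivot = inj₂ (cofactor-kernel-vector M (pivots r) (det≉0 r)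
    λ j → decidable-stable (_ ≈? 0ℤ) (λ det≉0 → no-pivot (j , det≉0)))

  fullRowRank⇒rows≤columns : ∀ {k m} {M : Matrix k m} → FullRowRank M → k ≤ m
  fullRowRank⇒rows≤columns {k} {m} {M} r with k ℕₚ.≤? m
  ... | yes k≤m = k≤m
  ... | no k≰m with i , j , i<j , σi≡σj ← pigeonhole (ℕₚ.≰⇒> k≰m) (pivots r) =
    ⊥-elim (det≉0 r (≈-reflexive
      (det-equal-columns (M ⇂ pivots r) (<⇒≢ i<j) (λ l → cong (M l) σi≡σj))))

  -- δ c ∷ M has more rows than columns, so the dichotomy yields a kernel vector b; its
  -- head is invertible because the rows of M are independent, and ℓ = − b₀⁻¹ (b ∘ suc).
  left-inverse-row : ∀ {d} (M : Matrix d d) → RowsIndependent M → ∀ c → ∃ λ ℓ → ∀ j → (ℓ ⊛ M) j ≈ δ c j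
  left-inverse-row M independent c with fullRowRank⊎smallLeftKernelVector (δ c ∷ M)
  ... | inj₁ r = ⊥-elim (ℕₚ.1+n≰n (fullRowRank⇒rows≤columns r))
  ... | inj₂ v = solve (≉0⇒invertible b₀≉0)
    where
    b = vector v
    b₀≉0 : b zero ≉ 0ℤ
    b₀≉0 b₀≈0 = let i , bᵢ≉0 = nonzero v in bᵢ≉0 (b≈0 i)
      where
      b≈0 : ∀ i → b i ≈ 0ℤ
      b≈0 zero = b₀≈0
      b≈0 (suc i) = independent (b ∘ suc) (λ j → ⊛-tail≈0 b (δ c ∷ M) b₀≈0 j (annihilates v j)) i
    solve : (∃ λ u → u * b zero ≈ 1ℤ) → ∃ λ ℓ → ∀ j → (ℓ ⊛ M) j ≈ δ c j
    solve (u , u*b₀≈1) = (λ i → - u * b (suc i)) , λ j → begin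
      ((λ i → - u * b (suc i)) ⊛ M) j     ≡⟨ ⊛-scale (- u) (b ∘ suc) M j ⟩
      - u * (b ∘ suc ⊛ M) j               ≈⟨ *-congˡ (- u) (y≈-x (annihilates v j)) ⟩
      - u * - (b zero * δ c j)            ≡⟨ rearrange u (b zero) (δ c j) ⟩
      u * b zero * δ c j                  ≈⟨ *-congʳ (δ c j) u*b₀≈1 ⟩
      1ℤ * δ c j                          ≡⟨ ℤₚ.*-identityˡ (δ c j) ⟩
      δ c j                               ∎
      where
      open ≈-Reasoning
      rearrange : ∀ u b e → - u * - (b * e) ≡ u * b * e
      rearrange = solve-∀

  left-inverse⇒right-inverse : ∀ {d} (M L : Matrix d d) → RowsIndependent M →
    (∀ c j → (L c ⊛ M) j ≈ δ c j) → ∀ r c → (M r ⊛ L) c ≈ δ r c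
  left-inverse⇒right-inverse M L independent LM≈I r =
    x-y≈0⇒x≈y ∘ independent (λ c → (M r ⊛ L) c - δ r c) λ j → begin
      ((λ c → (M r ⊛ L) c - δ r c) ⊛ M) j      ≡⟨ ⊛-sub (M r ⊛ L) (δ r) M j ⟩
      ((M r ⊛ L) ⊛ M) j - (δ r ⊛ M) j           ≡⟨ cong₂ _-_ (⊛-assoc (M r) L M j) (δ-⊛ r M j) ⟩
      (M r ⊛ (λ i → L i ⊛ M)) j - M r j         ≈⟨ +-congʳ (- M r j) (⊛-congʳ (M r) LM≈I j) ⟩
      (M r ⊛ δ) j - M r j                       ≡⟨ cong (_- M r j) (⊛-δ (M r) j) ⟩
      M r j - M r j                             ≡⟨ ℤₚ.+-inverseʳ (M r j) ⟩
      0ℤ                                        ∎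
    where open ≈-Reasoning

  rowsIndependent⇒invertible : ∀ {d} (T : Mat p d) → RowsIndependent (liftᴹ T) → Invertible T
  rowsIndependent⇒invertible T independent = S , ST≡I , TS≡I
    where
    M = liftᴹ T
    L : Matrix _ _
    L c = proj₁ (left-inverse-row M independent c)
    LM≈I : ∀ c j → (L c ⊛ M) j ≈ δ c j
    LM≈I c = proj₂ (left-inverse-row M independent c)
    S : Mat p _
    S i j = reduce (L i j)
    ST≡I : ∀ i j → (S · T) i j ≡ I i j
    ST≡I i j = trans
      (⋆≡mod (S i) T (L i) M (toℕ-reduce≈ ∘ L i) (λ k → toℕ≈lift ∘ T k) (LM≈I i j))
      (δ-mod≡I i j)
    TS≡I : ∀ i j → (T · S) i j ≡ I i j
    TS≡I i j = trans
      (⋆≡mod (T i) S (M i) L (toℕ≈lift ∘ T i) (λ k → toℕ-reduce≈ ∘ L k)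
        (left-inverse⇒right-inverse M L independent LM≈I i j))
      (δ-mod≡I i j)

  reduce-kernel-vector : ∀ {d C} (T : Mat p d) → 1 ≤ C → (∀ i j → height (T i j) ≤ C) →
    SmallLeftKernelVector (liftᴹ T) →
    Σ (Vecp p d) λ a → (∃ λ i → a i ≢ 0ₚ)
                     × (∀ i → height (a i) ≤ d ! ℕ.* C ℕ.^ d)
                     × (∀ j → (a ⋆ T) j ≡ 0ₚ)
  reduce-kernel-vector T 1≤C T≤C v =
    reduce ∘ vector v
    , (let i , vᵢ≉0 = nonzero v in i , reduce≢0ₚ vᵢ≉0)
    , (λ i → ℕₚ.≤-trans (height-reduce≤ (vector v i)) (small v 1≤C (liftᴹ-bounded T T≤C) i))
    , (λ j → ⋆≡mod (reduce ∘ vector v) T (vector v) (liftᴹ T) (toℕ-reduce≈ ∘ vector v)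
                   (λ i → toℕ≈lift ∘ T i) (annihilates v j))

-- The integer operators are opened only inside the modules above, so here _*_ is ℕ's.
open import Data.Nat.Base using (_*_; _^_)

lemma4 : (p : ℕ) .{{_ : NonZero p}} → Prime p → (d : ℕ) → (T : Mat p d) → (C : ℕ) → 1 ≤ C
       → ((i j : Fin d) → height (T i j) ≤ C)
       → ¬ Invertible T
       → Σ (Vecp p d) (λ a → (∃ λ i → a i ≢ 0ₚ)
                             × ((i : Fin d) → height (a i) ≤ (d !) * C ^ d)
                             × ((j : Fin d) → (a ⋆ T) j ≡ 0ₚ))
lemma4 p p-prime d T C 1≤C T≤C ¬invertible = case fullRowRank⊎smallLeftKernelVector (liftᴹ T) of λ where
    (inj₁ rank) → ⊥-elim (¬invertible (rowsIndependent⇒invertible T (FullRowRank.rows-independent rank)))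
    (inj₂ v) → reduce-kernel-vector T 1≤C T≤C v
  where open PrimeModulus p-prime
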